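{- Let $P$ be a trapezoid order on a finite ground set such that $P = X\cap S$, where $X$ is an interval order and $S$ is a semiorder on the same ground set. Then $P$ is a unit trapezoid order.
   Context: The intersection $X\cap S$ of two orders on the same ground set is the order in which $x<y$ if and only if $x<y$ in both $X$ and $S$. A trapezoid representation of an order uses two parallel baselines. Each element $x$ is assigned a closed interval $[l(x),r(x)]$ on the lower baseline and a closed interval $[L(x),R(x)]$ on the upper baseline, and its trapezoid $T_x$ is the convex hull of these two intervals. The representation requires $x\prec y$ if and only if $r(x)<l(y)$ and $R(x)<L(y)$. A trapezoid order is an order with such a representation. A unit trapezoid order is one having a trapezoid representation in which all trapezoids have the same area, equivalently the sum of the two base lengths is the same for every element. An interval order is an order representable by closed real intervals, with $x<y$ if and only if the interval of $x$ lies entirely to the left of the interval of $y$. A semiorder is an interval order having such a representation with all intervals of the same length.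
   Formalization: The interval endpoints in the representations of the interval order, the semiorder and the (unit) trapezoid orders are rational numbers instead of real numbers. -}

module Defs where

open import Data.Nat using (ℕ)
open import Data.Fin using (Fin)
open import Data.Rational using (ℚ; _<_; _≤_; _+_; _-_)
open import Data.Product using (_×_; Σ; ∃; ∃-syntax)
open import Function.Bundles using (_⇔_)
open import Relation.Binary.PropositionalEquality using (_≡_)

Rel₀ : ℕ → Set₁
Rel₀ n = Fin n → Fin n → Set

_∩_ : ∀ {n} → Rel₀ n → Rel₀ n → Rel₀ n
(X ∩ S) x y = X x y × S x y

SameRel : ∀ {n} → Rel₀ n → Rel₀ n → Set
SameRel P Q = ∀ x y → P x y ⇔ Q x y

record IntervalRep (n : ℕ) : Set where
  field
    l r : Fin n → ℚ
    l≤r : ∀ x → l x ≤ r x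

IntervalRepresents : ∀ {n} → IntervalRep n → Rel₀ n → Set
IntervalRepresents I P = ∀ x y → P x y ⇔ (r x < l y)
  where open IntervalRep I

IsIntervalOrder : ∀ {n} → Rel₀ n → Set
IsIntervalOrder {n} P = ∃[ I ] IntervalRepresents {n} I P

IsSemiorder : ∀ {n} → Rel₀ n → Set
IsSemiorder {n} P =
  ∃[ I ] (IntervalRepresents {n} I P ×
          ∃[ c ] (∀ x → IntervalRep.r I x - IntervalRep.l I x ≡ c))

-- Trapezoid representation: lower interval [l x , r x], upper interval [L x , R x].
record TrapRep (n : ℕ) : Set where
  field
    l r L R : Fin n → ℚ
    l≤r : ∀ x → l x ≤ r x
    L≤R : ∀ x → L x ≤ R x

TrapRepresents : ∀ {n} → TrapRep n → Rel₀ n → Set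
TrapRepresents T P = ∀ x y → P x y ⇔ (r x < l y × R x < L y)
  where open TrapRep T

IsTrapezoidOrder : ∀ {n} → Rel₀ n → Set
IsTrapezoidOrder {n} P = ∃[ T ] TrapRepresents {n} T P

-- Unit trapezoid order: all trapezoids have the same area, i.e. the sum of
-- the two base lengths is the same for every element.
IsUnitTrapezoidOrder : ∀ {n} → Rel₀ n → Set
IsUnitTrapezoidOrder {n} P =
  ∃[ T ] (TrapRepresents {n} T P ×
          ∃[ A ] (∀ x → (TrapRep.r T x - TrapRep.l T x)
                         + (TrapRep.R T x - TrapRep.L T x) ≡ A))

{-# OPTIONS --safe #-}
module Submission where

open import Data.Nat using (ℕ; zero; suc)
open import Data.Fin using (Fin; zero; suc)
open import Data.Rational
  using (ℚ; _<_; _≤_; _+_; _-_; _*_; -_; 0ℚ; 1ℚ; 1/_; _⊓_; _⊔_; _<?_;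
         Positive; NonNegative; NonZero; positive; nonNegative)
open import Data.Rational.Properties
open import Data.Rational.Solver using (module +-*-Solver)
open import Data.Product using (_×_; ∃-syntax; _,_; proj₁; proj₂)
open import Data.Product.Function.NonDependent.Propositional using (_×-⇔_)
open import Data.Sum using (inj₁; inj₂)
open import Data.Unit using (⊤; tt)
open import Data.Empty using (⊥-elim)
open import Function using (_∘_)
open import Function.Bundles using (_⇔_; mk⇔)
open import Function.Construct.Composition using (_⇔-∘_)
open import Relation.Nullary using (yes; no)
open import Relation.Unary using (Pred; Decidable)
open import Relation.Binary.PropositionalEquality
  using (_≡_; refl; sym; trans; cong; cong₂; subst; module ≡-Reasoning)
open import Level using (0ℓ)

open import Defs

-- Idea: keep the intervals of X as lower bases.  On the upper baseline take
-- the semiorder intervals [c x , d x] (all of width k), stretched by a factor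
-- Λ, and lengthen each one to the right by M - |I x|, where M bounds the widths
-- of the intervals I x of X.  Every trapezoid then has area |I x| + Λ k + M - |I x|
-- = Λ k + M.  Choosing Λ so that Λ times the least positive gap d x < c y
-- exceeds M, the padding never closes a gap, so the upper bases still
-- represent S and the trapezoids represent X ∩ S.

p<q⇒0<q-p : ∀ {p q} → p < q → 0ℚ < q - p
p<q⇒0<q-p {p} {q} p<q = subst (_< q - p) (+-inverseʳ p) (+-monoˡ-< (- p) p<q)

p≤q⇒0≤q-p : ∀ {p q} → p ≤ q → 0ℚ ≤ q - p
p≤q⇒0≤q-p {p} {q} p≤q = subst (_≤ q - p) (+-inverseʳ p) (+-monoˡ-≤ (- p) p≤q)

p≤p+q : ∀ p {q} → 0ℚ ≤ q → p ≤ p + q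
p≤p+q p {q} 0≤q = subst (_≤ p + q) (+-identityʳ p) (+-monoʳ-≤ p 0≤q)

p<p+q : ∀ p {q} → 0ℚ < q → p < p + q
p<p+q p {q} 0<q = subst (_< p + q) (+-identityʳ p) (+-monoʳ-< p 0<q)

p-q≤p : ∀ p {q} → 0ℚ ≤ q → p - q ≤ p
p-q≤p p {q} 0≤q = subst (p - q ≤_) p-q+q≡p (p≤p+q (p - q) 0≤q)
  where
  open +-*-Solver
  p-q+q≡p : p - q + q ≡ p
  p-q+q≡p = solve 2 (λ p q → p :- q :+ q := p) refl p q

0<p⊓q : ∀ {p q} → 0ℚ < p → 0ℚ < q → 0ℚ < p ⊓ q
0<p⊓q {p} {q} 0<p 0<q with ⊓-sel p q
... | inj₁ p⊓q≡p = subst (0ℚ <_) (sym p⊓q≡p) 0<p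
... | inj₂ p⊓q≡q = subst (0ℚ <_) (sym p⊓q≡q) 0<q

positive-lower-bound : ∀ {n} {Q : Pred (Fin n) 0ℓ} → Decidable Q → (f : Fin n → ℚ) →
                       (∀ x → Q x → 0ℚ < f x) →
                       ∃[ m ] (0ℚ < m × ∀ x → Q x → m ≤ f x)
positive-lower-bound {zero} Q? f f>0 = 1ℚ , positive⁻¹ 1ℚ , λ ()
positive-lower-bound {suc n} Q? f f>0
  with positive-lower-bound (Q? ∘ suc) (f ∘ suc) (f>0 ∘ suc) | Q? zero
... | m , 0<m , m≤f | no ¬Q0 = m , 0<m , λ { zero Q0 → ⊥-elim (¬Q0 Q0)
                                            ; (suc x) Qx → m≤f x Qx }
... | m , 0<m , m≤f | yes Q0 =
  m ⊓ f zero , 0<p⊓q 0<m (f>0 zero Q0) ,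
  λ { zero _ → p⊓q≤q m (f zero) ; (suc x) Qx → ≤-trans (p⊓q≤p m (f zero)) (m≤f x Qx) }

nonNegative-upper-bound : ∀ {n} (f : Fin n → ℚ) → ∃[ M ] (0ℚ ≤ M × ∀ x → f x ≤ M)
nonNegative-upper-bound {zero} f = 0ℚ , ≤-refl , λ ()
nonNegative-upper-bound {suc n} f with nonNegative-upper-bound (f ∘ suc)
... | M , 0≤M , f≤M =
  M ⊔ f zero , ≤-trans 0≤M (p≤p⊔q M (f zero)) ,
  λ { zero → p≤q⊔p M (f zero) ; (suc x) → ≤-trans (f≤M x) (p≤p⊔q M (f zero)) }

least-positive-gap : ∀ {n} (c d : Fin n → ℚ) →
                     ∃[ m ] (0ℚ < m × ∀ x y → d x < c y → m ≤ c y - d x)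
least-positive-gap c d =
  let m , 0<m , m≤row = positive-lower-bound {Q = λ _ → ⊤} (λ _ → yes tt)
                          (proj₁ ∘ row) (λ x _ → proj₁ (proj₂ (row x)))
  in m , 0<m , λ x y dx<cy → ≤-trans (m≤row x tt) (proj₂ (proj₂ (row x)) y dx<cy)
  where
  row : ∀ x → ∃[ m ] (0ℚ < m × ∀ y → d x < c y → m ≤ c y - d x)
  row x = positive-lower-bound (λ y → d x <? c y) (λ y → c y - d x) (λ y → p<q⇒0<q-p)

separating-scale : ∀ {n} (c d : Fin n → ℚ) {B} → 0ℚ ≤ B →
                   ∃[ Λ ] (0ℚ ≤ Λ × ∀ x y → d x < c y → Λ * d x + B < Λ * c y)
separating-scale c d {B} 0≤B with least-positive-gap c d
... | m , 0<m , m≤gap = Λ , 0≤Λ , separates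
  where
  instance
    m-pos : Positive m
    m-pos = positive 0<m
    m-nonZero : NonZero m
    m-nonZero = pos⇒nonZero m
    B-nonNeg : NonNegative B
    B-nonNeg = nonNegative 0≤B
    1/m-nonNeg : NonNegative (1/ m)
    1/m-nonNeg = pos⇒nonNeg (1/ m) {{1/pos⇒pos m}}
    B/m-nonNeg : NonNegative (B * 1/ m)
    B/m-nonNeg = nonNeg*nonNeg⇒nonNeg B (1/ m)

  Λ : ℚ
  Λ = B * 1/ m + 1ℚ

  instance
    Λ-nonNeg : NonNegative Λ
    Λ-nonNeg = pos⇒nonNeg Λ {{nonNeg+pos⇒pos (B * 1/ m) 1ℚ}}

  0≤Λ : 0ℚ ≤ Λ
  0≤Λ = nonNegative⁻¹ Λ

  Λm≡B+m : Λ * m ≡ B + m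
  Λm≡B+m = begin
    (B * 1/ m + 1ℚ) * m     ≡⟨ *-distribʳ-+ m (B * 1/ m) 1ℚ ⟩
    B * 1/ m * m + 1ℚ * m   ≡⟨ cong₂ _+_ (*-assoc B (1/ m) m) (*-identityˡ m) ⟩
    B * (1/ m * m) + m      ≡⟨ cong (λ z → B * z + m) (*-inverseˡ m) ⟩
    B * 1ℚ + m              ≡⟨ cong (_+ m) (*-identityʳ B) ⟩
    B + m                   ∎
    where open ≡-Reasoning

  separates : ∀ x y → d x < c y → Λ * d x + B < Λ * c y
  separates x y dx<cy = begin-strict
    Λ * d x + B                <⟨ +-monoʳ-< (Λ * d x) (p<p+q B 0<m) ⟩
    Λ * d x + (B + m)          ≡⟨ cong (Λ * d x +_) (sym Λm≡B+m) ⟩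
    Λ * d x + Λ * m            ≤⟨ +-monoʳ-≤ (Λ * d x) (*-monoˡ-≤-nonNeg Λ (m≤gap x y dx<cy)) ⟩
    Λ * d x + Λ * (c y - d x)  ≡⟨ solve 3 (λ Λ dx cy → Λ :* dx :+ Λ :* (cy :- dx) := Λ :* cy)
                                        refl Λ (d x) (c y) ⟩
    Λ * c y                    ∎
    where open ≤-Reasoning
          open +-*-Solver

width : ∀ {n} → IntervalRep n → Fin n → ℚ
width I x = IntervalRep.r I x - IntervalRep.l I x

module PaddedTrapezoids {n} (I J : IntervalRep n) (Λ M : ℚ) (0≤Λ : 0ℚ ≤ Λ)
                        (width≤M : ∀ x → width I x ≤ M) where
  open IntervalRep I using (l; r; l≤r)
  open IntervalRep J renaming (l to c; r to d; l≤r to c≤d)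

  instance
    Λ-nonNeg : NonNegative Λ
    Λ-nonNeg = nonNegative 0≤Λ

  L R : Fin n → ℚ
  L y = Λ * c y
  R x = Λ * d x + (M - width I x)

  R-lower-bound : ∀ x → Λ * d x ≤ R x
  R-lower-bound x = p≤p+q (Λ * d x) (p≤q⇒0≤q-p (width≤M x))

  R-upper-bound : ∀ x → R x ≤ Λ * d x + M
  R-upper-bound x = +-monoʳ-≤ (Λ * d x) (p-q≤p M (p≤q⇒0≤q-p (l≤r x)))

  trapezoids : TrapRep n
  trapezoids = record
    { l = l ; r = r ; L = L ; R = R ; l≤r = l≤r
    ; L≤R = λ x → ≤-trans (*-monoˡ-≤-nonNeg Λ (c≤d x)) (R-lower-bound x) }

  area : ∀ x → (r x - l x) + (R x - L x) ≡ Λ * width J x + M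
  area x = solve 6 (λ l r c d Λ M → (r :- l) :+ ((Λ :* d :+ (M :- (r :- l))) :- Λ :* c)
                                    := Λ :* (d :- c) :+ M)
                   refl (l x) (r x) (c x) (d x) Λ M
    where open +-*-Solver

  Separated : Set
  Separated = ∀ x y → d x < c y → Λ * d x + M < Λ * c y

  d<c⇔R<L : Separated → ∀ x y → d x < c y ⇔ R x < L y
  d<c⇔R<L separated x y = mk⇔ d<c⇒R<L R<L⇒d<c
    where
    d<c⇒R<L : d x < c y → R x < L y
    d<c⇒R<L dx<cy = ≤-<-trans (R-upper-bound x) (separated x y dx<cy)

    R<L⇒d<c : R x < L y → d x < c y
    R<L⇒d<c Rx<Ly = *-cancelˡ-<-nonNeg Λ (≤-<-trans (R-lower-bound x) Rx<Ly)

  represents-∩ : ∀ {X S} → IntervalRepresents I X → IntervalRepresents J S → Separated →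
                 TrapRepresents trapezoids (X ∩ S)
  represents-∩ I↦X J↦S separated x y =
    I↦X x y ×-⇔ (d<c⇔R<L separated x y ⇔-∘ J↦S x y)

lemma5 : (n : ℕ) (P X S : Rel₀ n) →
         IsTrapezoidOrder P → IsIntervalOrder X → IsSemiorder S →
         SameRel P (X ∩ S) → IsUnitTrapezoidOrder P
lemma5 n P X S _ (I , I↦X) (J , J↦S , k , width-J≡k) P⇔X∩S =
  let M , 0≤M , width-I≤M = nonNegative-upper-bound (width I)
      Λ , 0≤Λ , separated = separating-scale (IntervalRep.l J) (IntervalRep.r J) 0≤M
      open PaddedTrapezoids I J Λ M 0≤Λ width-I≤M
  in trapezoids ,
     (λ x y → represents-∩ I↦X J↦S separated x y ⇔-∘ P⇔X∩S x y) ,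
     Λ * k + M ,
     (λ x → trans (area x) (cong (λ w → Λ * w + M) (width-J≡k x)))
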